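{- Let $\mathtt{p}$ be a CF program and $x\in\{0,1\}^*$. If the computation tree $\mathcal{T}^{\mathtt{p},x}$ contains a judgement $\mathtt{p},\rho\vdash\mathtt{e}\to v$, then $v\in V_x$ and $\rho(\mathtt{z})\in V_x$ for every variable $\mathtt{z}$ in the domain of $\rho$.
   Context: CF is a first-order, call-by-value functional language with no data constructors. A CF program is a finite sequence of function definitions $\mathtt{f\ x1 \ldots xm = e}$; the first definition $\mathtt{f_1\ x = e}$ is the entry function. Expressions are $\mathtt{True}$, $\mathtt{False}$, $\mathtt{[\,]}$, variables, $\mathtt{not\ e}$, $\mathtt{null\ e}$, $\mathtt{head\ e}$, $\mathtt{tail\ e}$, $\mathtt{if\ e\ then\ e\ else\ e}$, and calls $\mathtt{f\ e1\ldots em}$. Values are bits $0,1$ (identified with False, True) or bit lists. The semantics is given by big-step rules $\mathtt{p},\rho\vdash\mathtt{e}\to v$, where $\rho$ is an environment: - $\mathtt{head}$ and $\mathtt{tail}$ of $b{:}bs$ give $b$ and $bs$. - $\mathtt{null}$ tests emptiness; $\mathtt{not}$ negates a bit. - A call evaluates its arguments, then the body in the new environment binding the parameters. - The run on input $x$ starts with the entry body in the environment $[\mathtt{x}\mapsto x]$. $\mathcal{T}^{\mathtt{p},x}$ is the derivation tree of the run on $x$. The set $V_x=\{0,1\}\cup\mathit{suffixes}(x)$, where the suffixes include $x$ itself and the empty list. -}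

module Defs where

open import Data.Nat using (ℕ; zero; suc)
open import Data.Bool using (Bool; true; false; not)
open import Data.Fin using (Fin)
open import Data.Vec using (Vec; []; _∷_; lookup)
open import Data.List using (List; []; _∷_)
open import Data.Maybe using (Maybe; just; nothing)
open import Data.Product using (Σ; _,_; _×_)
open import Relation.Binary.PropositionalEquality using (_≡_)
open import Data.List.Relation.Binary.Suffix.Heterogeneous using (Suffix)

-- Bits are identified with Booleans (0 = false = False, 1 = true = True).

data Val : Set where
  bit : Bool → Val
  lst : List Bool → Val

-- Expressions over m variables (the parameters of the enclosing function,
-- in scope-safe de Bruijn form). Function names are natural numbers,
-- indexing the program's definition list (0 = the entry function f1).
data Expr (m : ℕ) : Set where
  TRUE FALSE NIL : Expr m
  var  : Fin m → Expr m
  NOT NULL HEAD TAIL : Expr m → Expr m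
  IF   : Expr m → Expr m → Expr m → Expr m
  call : ℕ → {k : ℕ} → Vec (Expr m) k → Expr m

Def : Set
Def = Σ ℕ Expr

record Prog : Set where
  constructor prog
  field
    entry : Expr 1
    rest  : List Def

table : Prog → List Def
table p = (1 , Prog.entry p) ∷ Prog.rest p

_!_ : {A : Set} → List A → ℕ → Maybe A
[] ! _ = nothing
(a ∷ as) ! zero = just a
(a ∷ as) ! suc n = as ! n

Env : ℕ → Set
Env m = Vec Val m

mutual
  data _,_⊢_⇓_ (p : Prog) {m : ℕ} (ρ : Env m) : Expr m → Val → Set where
    eTrue  : p , ρ ⊢ TRUE ⇓ bit true
    eFalse : p , ρ ⊢ FALSE ⇓ bit false
    eNil   : p , ρ ⊢ NIL ⇓ lst []
    eVar   : (z : Fin m) → p , ρ ⊢ var z ⇓ lookup ρ z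
    eNot   : ∀ {e b} → p , ρ ⊢ e ⇓ bit b → p , ρ ⊢ NOT e ⇓ bit (not b)
    eNullT : ∀ {e} → p , ρ ⊢ e ⇓ lst [] → p , ρ ⊢ NULL e ⇓ bit true
    eNullF : ∀ {e b bs} → p , ρ ⊢ e ⇓ lst (b ∷ bs) → p , ρ ⊢ NULL e ⇓ bit false
    eHead  : ∀ {e b bs} → p , ρ ⊢ e ⇓ lst (b ∷ bs) → p , ρ ⊢ HEAD e ⇓ bit b
    eTail  : ∀ {e b bs} → p , ρ ⊢ e ⇓ lst (b ∷ bs) → p , ρ ⊢ TAIL e ⇓ lst bs
    eIfT   : ∀ {e₀ e₁ e₂ v} → p , ρ ⊢ e₀ ⇓ bit true → p , ρ ⊢ e₁ ⇓ v →
             p , ρ ⊢ IF e₀ e₁ e₂ ⇓ v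
    eIfF   : ∀ {e₀ e₁ e₂ v} → p , ρ ⊢ e₀ ⇓ bit false → p , ρ ⊢ e₂ ⇓ v →
             p , ρ ⊢ IF e₀ e₁ e₂ ⇓ v
    eCall  : ∀ {f k} {es : Vec (Expr m) k} {body : Expr k} {vs : Env k} {v} →
             table p ! f ≡ just (k , body) →
             p , ρ ⊢* es ⇓ vs →
             p , vs ⊢ body ⇓ v →
             p , ρ ⊢ call f es ⇓ v

  data _,_⊢*_⇓_ (p : Prog) {m : ℕ} (ρ : Env m) : {k : ℕ} → Vec (Expr m) k → Env k → Set where
    []  : p , ρ ⊢* [] ⇓ []
    _∷_ : ∀ {k e v} {es : Vec (Expr m) k} {vs} →
          p , ρ ⊢ e ⇓ v → p , ρ ⊢* es ⇓ vs → p , ρ ⊢* (e ∷ es) ⇓ (v ∷ vs)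

-- A judgement  p , ρ ⊢ e → v  (the program p is fixed by context).
record Judgement : Set where
  constructor judg
  field
    {arity} : ℕ
    env   : Env arity
    expr  : Expr arity
    value : Val

mutual
  data _occursIn_ {p : Prog} (J : Judgement) :
       {m : ℕ} {ρ : Env m} {e : Expr m} {v : Val} → p , ρ ⊢ e ⇓ v → Set where
    root    : ∀ {m} {ρ : Env m} {e v} {D : p , ρ ⊢ e ⇓ v} →
              J ≡ judg ρ e v → J occursIn D
    inNot   : ∀ {m} {ρ : Env m} {e b} {D : p , ρ ⊢ e ⇓ bit b} →
              J occursIn D → J occursIn (eNot D)
    inNullT : ∀ {m} {ρ : Env m} {e} {D : p , ρ ⊢ e ⇓ lst []} →
              J occursIn D → J occursIn (eNullT D)
    inNullF : ∀ {m} {ρ : Env m} {e b bs} {D : p , ρ ⊢ e ⇓ lst (b ∷ bs)} →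
              J occursIn D → J occursIn (eNullF D)
    inHead  : ∀ {m} {ρ : Env m} {e b bs} {D : p , ρ ⊢ e ⇓ lst (b ∷ bs)} →
              J occursIn D → J occursIn (eHead D)
    inTail  : ∀ {m} {ρ : Env m} {e b bs} {D : p , ρ ⊢ e ⇓ lst (b ∷ bs)} →
              J occursIn D → J occursIn (eTail D)
    inIfT₀  : ∀ {m} {ρ : Env m} {e₀ e₁ e₂ v} {D₀ : p , ρ ⊢ e₀ ⇓ bit true}
                {D₁ : p , ρ ⊢ e₁ ⇓ v} →
              J occursIn D₀ → J occursIn (eIfT {e₂ = e₂} D₀ D₁)
    inIfT₁  : ∀ {m} {ρ : Env m} {e₀ e₁ e₂ v} {D₀ : p , ρ ⊢ e₀ ⇓ bit true}
                {D₁ : p , ρ ⊢ e₁ ⇓ v} →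
              J occursIn D₁ → J occursIn (eIfT {e₂ = e₂} D₀ D₁)
    inIfF₀  : ∀ {m} {ρ : Env m} {e₀ e₁ e₂ v} {D₀ : p , ρ ⊢ e₀ ⇓ bit false}
                {D₂ : p , ρ ⊢ e₂ ⇓ v} →
              J occursIn D₀ → J occursIn (eIfF {e₁ = e₁} D₀ D₂)
    inIfF₂  : ∀ {m} {ρ : Env m} {e₀ e₁ e₂ v} {D₀ : p , ρ ⊢ e₀ ⇓ bit false}
                {D₂ : p , ρ ⊢ e₂ ⇓ v} →
              J occursIn D₂ → J occursIn (eIfF {e₁ = e₁} D₀ D₂)
    inArgs  : ∀ {m} {ρ : Env m} {f k} {es : Vec (Expr m) k} {body : Expr k}
                {vs : Env k} {v} {eq : table p ! f ≡ just (k , body)}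
                {Ds : p , ρ ⊢* es ⇓ vs} {Db : p , vs ⊢ body ⇓ v} →
              J occursIn* Ds → J occursIn (eCall {f = f} eq Ds Db)
    inBody  : ∀ {m} {ρ : Env m} {f k} {es : Vec (Expr m) k} {body : Expr k}
                {vs : Env k} {v} {eq : table p ! f ≡ just (k , body)}
                {Ds : p , ρ ⊢* es ⇓ vs} {Db : p , vs ⊢ body ⇓ v} →
              J occursIn Db → J occursIn (eCall {f = f} eq Ds Db)

  data _occursIn*_ {p : Prog} (J : Judgement) :
       {m k : ℕ} {ρ : Env m} {es : Vec (Expr m) k} {vs : Env k} →
       p , ρ ⊢* es ⇓ vs → Set where
    hd : ∀ {m k} {ρ : Env m} {e v} {es : Vec (Expr m) k} {vs}
           {D : p , ρ ⊢ e ⇓ v} {Ds : p , ρ ⊢* es ⇓ vs} →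
         J occursIn D → J occursIn* (D ∷ Ds)
    tl : ∀ {m k} {ρ : Env m} {e v} {es : Vec (Expr m) k} {vs}
           {D : p , ρ ⊢ e ⇓ v} {Ds : p , ρ ⊢* es ⇓ vs} →
         J occursIn* Ds → J occursIn* (D ∷ Ds)

-- V_x = {0,1} ∪ suffixes(x)  (suffixes include x itself and []).
data _∈V_ : Val → List Bool → Set where
  isBit    : ∀ {b x} → bit b ∈V x
  isSuffix : ∀ {ys x} → Suffix _≡_ ys x → lst ys ∈V x

-- Call an environment ρ *x-bounded* if all its values lie in V_x.  The proof
-- has two steps, both by induction on derivations.
--   1. Value bound: from an x-bounded environment, evaluation only yields
--      values in V_x.  Constants are bits or [], a variable is looked up in ρ,
--      tail of a suffix of x is again a suffix, and a call evaluates its body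
--      in the environment of argument values, which is x-bounded by induction.
--   2. Invariant along the tree: every judgement occurring in a derivation
--      from an x-bounded environment has an x-bounded environment (subtrees
--      share the environment, except call bodies, covered by step 1) and hence,
--      by step 1, a value in V_x.
-- The theorem follows since the run starts in the environment [x ↦ x], which
-- is x-bounded because x is a suffix of itself.
module Submission where

open import Defs
open import Data.List using (List; []; _∷_)
open import Data.List.Properties using (++-identityʳ)
open import Data.Bool using (Bool)
open import Data.Vec using (Vec; _∷_; []; lookup)
open import Data.Fin using (Fin; zero; suc)
open import Data.Product using (_×_; _,_)
open import Relation.Binary.PropositionalEquality using (_≡_; refl; subst)
open import Data.List.Relation.Binary.Suffix.Heterogeneous
  using (Suffix; here; tail; _++ˢ_)
import Data.List.Relation.Binary.Pointwise as Pointwise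

[]∈V : (x : List Bool) → lst [] ∈V x
[]∈V x = isSuffix (subst (Suffix _≡_ []) (++-identityʳ x) (x ++ˢ here Pointwise.[]))

self∈V : (x : List Bool) → lst x ∈V x
self∈V x = isSuffix (here (Pointwise.refl refl))

tail∈V : ∀ {x b bs} → lst (b ∷ bs) ∈V x → lst bs ∈V x
tail∈V (isSuffix s) = isSuffix (tail s)

Bounded : ∀ {m} → List Bool → Env m → Set
Bounded {m} x ρ = (z : Fin m) → lookup ρ z ∈V x

BoundedJudgement : List Bool → Judgement → Set
BoundedJudgement x J = (Judgement.value J ∈V x) × Bounded x (Judgement.env J)

mutual
  value-bound : ∀ {p m x} {ρ : Env m} {e v} →
                Bounded x ρ → p , ρ ⊢ e ⇓ v → v ∈V x
  value-bound ρ-ok eTrue            = isBit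
  value-bound ρ-ok eFalse           = isBit
  value-bound {x = x} ρ-ok eNil = []∈V x
  value-bound ρ-ok (eVar z)         = ρ-ok z
  value-bound ρ-ok (eNot _)         = isBit
  value-bound ρ-ok (eNullT _)       = isBit
  value-bound ρ-ok (eNullF _)       = isBit
  value-bound ρ-ok (eHead _)        = isBit
  value-bound ρ-ok (eTail D)        = tail∈V (value-bound ρ-ok D)
  value-bound ρ-ok (eIfT _ D)       = value-bound ρ-ok D
  value-bound ρ-ok (eIfF _ D)       = value-bound ρ-ok D
  value-bound ρ-ok (eCall _ Ds Db)  = value-bound (args-bound ρ-ok Ds) Db

  args-bound : ∀ {p m k x} {ρ : Env m} {es : Vec (Expr m) k} {vs : Env k} →
               Bounded x ρ → p , ρ ⊢* es ⇓ vs → Bounded x vs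
  args-bound ρ-ok (D ∷ _)  zero    = value-bound ρ-ok D
  args-bound ρ-ok (_ ∷ Ds) (suc z) = args-bound ρ-ok Ds z

mutual
  occurrence-bound : ∀ {p m x} {ρ : Env m} {e v} (J : Judgement) →
                     Bounded x ρ → (D : p , ρ ⊢ e ⇓ v) →
                     J occursIn D → BoundedJudgement x J
  occurrence-bound J ρ-ok D              (root refl) = value-bound ρ-ok D , ρ-ok
  occurrence-bound J ρ-ok (eNot D)       (inNot o)   = occurrence-bound J ρ-ok D o
  occurrence-bound J ρ-ok (eNullT D)     (inNullT o) = occurrence-bound J ρ-ok D o
  occurrence-bound J ρ-ok (eNullF D)     (inNullF o) = occurrence-bound J ρ-ok D o
  occurrence-bound J ρ-ok (eHead D)      (inHead o)  = occurrence-bound J ρ-ok D o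
  occurrence-bound J ρ-ok (eTail D)      (inTail o)  = occurrence-bound J ρ-ok D o
  occurrence-bound J ρ-ok (eIfT D _)     (inIfT₀ o)  = occurrence-bound J ρ-ok D o
  occurrence-bound J ρ-ok (eIfT _ D)     (inIfT₁ o)  = occurrence-bound J ρ-ok D o
  occurrence-bound J ρ-ok (eIfF D _)     (inIfF₀ o)  = occurrence-bound J ρ-ok D o
  occurrence-bound J ρ-ok (eIfF _ D)     (inIfF₂ o)  = occurrence-bound J ρ-ok D o
  occurrence-bound J ρ-ok (eCall _ Ds _) (inArgs o)  = args-occurrence-bound J ρ-ok Ds o
  occurrence-bound J ρ-ok (eCall _ Ds Db) (inBody o) =
    occurrence-bound J (args-bound ρ-ok Ds) Db o

  args-occurrence-bound : ∀ {p m k x} {ρ : Env m} {es : Vec (Expr m) k} {vs : Env k}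
                          (J : Judgement) → Bounded x ρ → (Ds : p , ρ ⊢* es ⇓ vs) →
                          J occursIn* Ds → BoundedJudgement x J
  args-occurrence-bound J ρ-ok (D ∷ _)  (hd o) = occurrence-bound J ρ-ok D o
  args-occurrence-bound J ρ-ok (_ ∷ Ds) (tl o) = args-occurrence-bound J ρ-ok Ds o

initial-bounded : (x : List Bool) → Bounded x (lst x ∷ [])
initial-bounded x zero = self∈V x

lemma2 : (p : Prog) (x : List Bool) {v : Defs.Val}
    (D : p , (lst x ∷ []) ⊢ Prog.entry p ⇓ v)
    (J : Judgement) → J occursIn D →
    (Judgement.value J ∈V x) ×
    ((z : Fin (Judgement.arity J)) → lookup (Judgement.env J) z ∈V x)
lemma2 p x D J J∈D = occurrence-bound J (initial-bounded x) D J∈D
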